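{- If $M$ is a matroid, $D\subseteq E(M)$, and $N=M\setminus D$, then the c$^*$d-depth of $N$ is at most the c$^*$d-depth of $M$.
   Context: A component of a matroid is an inclusion-wise maximal set of elements any two of which lie in a common circuit; $M$ is connected if it has one component. $M'$ is a c$^*$-transformation of $M$ if there are a matroid $M^+$ and $f\in E(M^+)$ with $M=M^+\setminus f$ and $M'=M^+/f$. The c$^*$d-depth of $M$ is: $1$ if $|E(M)|\le1$; the maximum c$^*$d-depth of the restrictions of $M$ to its components if $M$ is not connected; and if $M$ is connected, $1+$ the minimum c$^*$d-depth of a matroid $M'\ne M$ that is either $M\setminus e$ for some $e\in E(M)$ or a c$^*$-transformation of $M$. -}

module Defs where

open import Data.Nat using (ℕ; zero; suc; _≤_)
open import Data.Bool using (Bool; true; false; T; not; _∨_)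
open import Data.Unit using (tt)
open import Data.Maybe using (Maybe; just; nothing)
open import Data.Product using (Σ; _×_; _,_; ∃; ∃-syntax)
open import Data.List using (List)
open import Data.List.Membership.Propositional using (_∈_)
open import Relation.Nullary using (¬_)
open import Relation.Nullary.Decidable using (⌊_⌋)
open import Relation.Binary.Definitions using (DecidableEquality)
open import Relation.Binary.PropositionalEquality using (_≡_; _≢_)
open import Level using () renaming (suc to lsuc; zero to lzero)

Subset : Set → Set
Subset E = E → Bool

module _ {E : Set} where

  _∈ₛ_ : E → Subset E → Set
  x ∈ₛ X = X x ≡ true

  _⊆_ : Subset E → Subset E → Set
  X ⊆ Y = ∀ x → x ∈ₛ X → x ∈ₛ Y

  _≗ₛ_ : Subset E → Subset E → Set
  X ≗ₛ Y = ∀ x → X x ≡ Y x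

  Nonempty : Subset E → Set
  Nonempty X = ∃[ x ] (x ∈ₛ X)

  ∅ₛ : Subset E
  ∅ₛ _ = false

Sub : {E : Set} → Subset E → Set
Sub {E} S = Σ E (λ x → T (S x))

-- A subset of Sub S viewed as a subset of E.
liftSub : {E : Set} (S : Subset E) → Subset (Sub S) → Subset E
liftSub S X x = go (S x) (λ p → X (x , p))
  where
  go : (b : Bool) → (T b → Bool) → Bool
  go true  g = g tt
  go false g = false

liftJust : {E : Set} → Subset E → Subset (Maybe E)
liftJust X nothing  = false
liftJust X (just x) = X x

-- Matroids on a finite ground set E, given by their circuits
-- (circuit axioms (C1)–(C3), Oxley, Matroid Theory, §1.1).

record Matroid (E : Set) : Set where
  field
    enum      : List E
    complete  : ∀ x → x ∈ enum
    _≟_       : DecidableEquality E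
    isCircuit : Subset E → Bool
    resp      : ∀ X Y → X ≗ₛ Y → isCircuit X ≡ isCircuit Y
    C1        : isCircuit ∅ₛ ≡ false
    C2        : ∀ X Y → isCircuit X ≡ true → isCircuit Y ≡ true → X ⊆ Y → X ≗ₛ Y
    C3        : ∀ X Y e → isCircuit X ≡ true → isCircuit Y ≡ true → ¬ (X ≗ₛ Y) →
                e ∈ₛ X → e ∈ₛ Y →
                ∃[ Z ] (isCircuit Z ≡ true × (∀ x → x ∈ₛ Z → ((X x ∨ Y x) ≡ true × x ≢ e)))

open Matroid public

module _ {E : Set} where

  SameMatroid : Matroid E → Matroid E → Set
  SameMatroid M M' = ∀ X → isCircuit M X ≡ isCircuit M' X

  -- M' is the restriction M | S of M to S (equivalently M \ (E - S)).
  IsRestriction : (M : Matroid E) (S : Subset E) → Matroid (Sub S) → Set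
  IsRestriction M S M' = ∀ X → isCircuit M' X ≡ isCircuit M (liftSub S X)

  allBut : Matroid E → E → Subset E
  allBut M e x = not ⌊ _≟_ M x e ⌋

  AtMostOne : Set
  AtMostOne = ∀ (x y : E) → x ≡ y

  CommonCircuitSet : Matroid E → Subset E → Set
  CommonCircuitSet M X = ∀ x y → x ∈ₛ X → y ∈ₛ X → x ≢ y →
    ∃[ C ] (isCircuit M C ≡ true × x ∈ₛ C × y ∈ₛ C)

  Component : Matroid E → Subset E → Set
  Component M X = CommonCircuitSet M X × (∀ Y → X ⊆ Y → CommonCircuitSet M Y → Y ⊆ X)

  Connected : Matroid E → Set
  Connected M = ∃[ X ] (Component M X × (∀ Y → Component M Y → Y ≗ₛ X))

-- M⁺ on E ∪ {f} (with E ∪ {f} realised as Maybe E and f = nothing);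
-- M = M⁺ \ f.
IsDeletionOfNew : {E : Set} → Matroid (Maybe E) → Matroid E → Set
IsDeletionOfNew M⁺ M = ∀ X → isCircuit M X ≡ isCircuit M⁺ (liftJust X)

-- M' = M⁺ / f: circuits are the minimal nonempty sets of the form C - f,
-- C a circuit of M⁺ (Oxley, Prop. 3.1.11).
module _ {E : Set} where
  TraceOfCircuit : Matroid (Maybe E) → Subset E → Set
  TraceOfCircuit M⁺ X = Nonempty X ×
    ∃[ C ] (isCircuit M⁺ C ≡ true × (∀ x → C (just x) ≡ X x))

_⇔ₚ_ : Set → Set → Set
A ⇔ₚ B = (A → B) × (B → A)
infix 3 _⇔ₚ_

IsContractionOfNew : {E : Set} → Matroid (Maybe E) → Matroid E → Set
IsContractionOfNew M⁺ M' = ∀ X → (isCircuit M' X ≡ true) ⇔ₚ (TraceOfCircuit M⁺ X ×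
    (∀ Y → TraceOfCircuit M⁺ Y → Y ⊆ X → X ⊆ Y))

CStarTransformation : {E : Set} → Matroid E → Matroid E → Set
CStarTransformation {E} M M' = ∃[ M⁺ ] (IsDeletionOfNew {E} M⁺ M × IsContractionOfNew M⁺ M')

-- c*d-depth, as the least fixed point of the recursive definition:
-- Depth≤ k M  means "the c*d-depth of M is at most k".

TwoElements : Set → Set
TwoElements E = ∃[ x ] ∃[ y ] (_≢_ {A = E} x y)

data Depth≤ : ℕ → {E : Set} → Matroid E → Set₁ where
  small : ∀ {k E} {M : Matroid E} → 1 ≤ k → AtMostOne {E} → Depth≤ k M
  -- M not connected : maximum over the restrictions to the components
  disconnected : ∀ {k E} {M : Matroid E} → TwoElements E → ¬ Connected M →
    (∀ C → Component M C → (MC : Matroid (Sub C)) → IsRestriction M C MC → Depth≤ k MC) →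
    Depth≤ k M
  deletion : ∀ {k E} {M : Matroid E} → TwoElements E → Connected M →
    (e : E) (M' : Matroid (Sub (allBut M e))) → IsRestriction M (allBut M e) M' →
    Depth≤ k M' → Depth≤ (suc k) M
  cstar : ∀ {k E} {M : Matroid E} → TwoElements E → Connected M →
    (M' : Matroid E) → ¬ SameMatroid M' M → CStarTransformation M M' →
    Depth≤ k M' → Depth≤ (suc k) M

IsCdDepth : {E : Set} → Matroid E → ℕ → Set₁
IsCdDepth M d = Depth≤ d M × (∀ k → Depth≤ k M → d ≤ k)

{-# OPTIONS --safe #-}
-- Every restriction N of M (with ground set transported along an injection ι) satisfies
-- Depth≤ k N whenever Depth≤ k M; this is proved by induction on the derivation of Depth≤ k M.
-- Splitting N into its components, each again a restriction of M, reduces the claim to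
-- connected N with at least two elements.  If M is disconnected, such an N lies inside one
-- component of M.  If M is connected and M ∖ e has depth below k, then either e = ι f and
-- N ∖ f is a restriction of M ∖ e, or N itself is one.  If M′ = M⁺ / f is a c*-transformation
-- of M = M⁺ ∖ f, restricting M⁺ to ι(E(N)) ∪ {f} gives a c*-transformation N′ of N which is a
-- restriction of M′; when N′ = N, N is itself a restriction of M′.  Ground sets are finite, so
-- all these case distinctions are decidable.

module Submission where

open import Defs
open import Data.Nat using (ℕ; suc; _≤_; _<_; z≤n; s≤s)
open import Data.Nat.Properties using (m≤n⇒m≤1+n)
open import Data.Nat.Induction using (<-wellFounded)
open import Induction.WellFounded using (Acc; acc)
open import Data.Bool using (Bool; true; false; T; not; _∨_; if_then_else_)
open import Data.Bool.Properties using (T-irrelevant; ¬-not; T-≡) renaming (_≟_ to _≟ᵇ_)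
open import Data.Unit using (tt)
open import Data.Empty using (⊥-elim)
open import Data.Maybe as Maybe using (Maybe; just; nothing)
open import Data.Maybe.Properties using (just-injective; map-injective) renaming (≡-dec to Maybe-≡-dec)
open import Data.Product using (_×_; _,_; proj₁; proj₂; ∃; ∃-syntax)
open import Data.Product.Properties using (≡-dec)
open import Data.Sum using (_⊎_; inj₁; inj₂)
open import Data.List as List using (List; []; _∷_; length; cartesianProductWith)
open import Data.List.Membership.Propositional using (_∈_; lose)
open import Data.List.Membership.Propositional.Properties using (∈-cartesianProductWith⁺; ∈-map⁺)
open import Data.List.Relation.Unary.Any using (Any; here; there; any?; satisfied)
open import Data.List.Relation.Unary.All as All using (all?)
open import Function using (_∘_; id)
open import Function.Bundles using (Equivalence)
open import Function.Definitions using (Injective)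
open import Relation.Nullary using (¬_; Dec; yes; no; does; contradiction)
open import Relation.Nullary.Decidable
  using (map′; dec-true; fromWitnessFalse; toWitnessFalse; _×-dec_; _→-dec_; T?; ¬?; decidable-stable)
open import Relation.Unary using (Pred; Decidable)
open import Relation.Binary using (Rel; Symmetric; _Respects_)
open import Relation.Binary.Definitions using (DecidableEquality)
open import Relation.Binary.PropositionalEquality using (_≡_; _≢_; refl; sym; trans; cong; cong₂; subst)
open Relation.Binary.PropositionalEquality.≡-Reasoning
open import Level using (0ℓ)

private
  variable
    E F : Set

bool-ext : ∀ {a b : Bool} → (a ≡ true → b ≡ true) → (b ≡ true → a ≡ true) → a ≡ b
bool-ext {false} {false} _   _   = refl
bool-ext {false} {true}  _   b⇒a = b⇒a refl
bool-ext {true}  {false} a⇒b _   = sym (a⇒b refl)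
bool-ext {true}  {true}  _   _   = refl

∨≡true⇒ : ∀ {a b} → a ∨ b ≡ true → a ≡ true ⊎ b ≡ true
∨≡true⇒ {true}  _   = inj₁ refl
∨≡true⇒ {false} b≡t = inj₂ b≡t

does≡true⇒ : {A : Set} (a? : Dec A) → does a? ≡ true → A
does≡true⇒ (yes a) _ = a

-- Search through a list covering A up to ≈: subsets can only be enumerated up to ≗ₛ.
module Exhaustive {A : Set} {_≈_ : Rel A 0ℓ} (≈-sym : Symmetric _≈_)
                  (xs : List A) (covers : ∀ x → ∃[ y ] (y ∈ xs × x ≈ y))
                  {P : Pred A 0ℓ} (resp : P Respects _≈_) (P? : Decidable P) where

  ∃? : Dec (∃ P)
  ∃? = map′ satisfied lose-P (any? P? xs)
    where
    lose-P : ∃ P → Any P xs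
    lose-P (x , Px) = let y , y∈xs , x≈y = covers x in lose y∈xs (resp x≈y Px)

  ∀? : Dec (∀ x → P x)
  ∀? = map′ lookup-P (λ ∀P → All.tabulate (λ {y} _ → ∀P y)) (all? P? xs)
    where
    lookup-P : All.All P xs → ∀ x → P x
    lookup-P all x = let y , y∈xs , x≈y = covers x in resp (≈-sym x≈y) (All.lookup all y∈xs)

module _ {A : Set} (_≟_ : DecidableEquality A) where

  update : A → Bool → Subset A → Subset A
  update a b X x = if does (x ≟ a) then b else X x

  subsets : List A → List (Subset A)
  subsets []       = ∅ₛ ∷ []
  subsets (a ∷ as) = cartesianProductWith (update a) (true ∷ false ∷ []) (subsets as)

  subsets-agree : ∀ as (X : Subset A) → ∃[ Y ] (Y ∈ subsets as × ∀ x → x ∈ as → X x ≡ Y x)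
  subsets-agree []       X = ∅ₛ , here refl , λ _ ()
  subsets-agree (a ∷ as) X with subsets-agree as X
  ... | Y , Y∈ , agree =
    update a (X a) Y , ∈-cartesianProductWith⁺ (update a) (bool∈ (X a)) Y∈ , agree′
    where
    bool∈ : ∀ b → b ∈ true ∷ false ∷ []
    bool∈ true  = here refl
    bool∈ false = there (here refl)
    agree′ : ∀ x → x ∈ a ∷ as → X x ≡ update a (X a) Y x
    agree′ x x∈ with x ≟ a | x∈
    ... | yes refl | _          = refl
    ... | no x≢a   | here x≡a   = contradiction x≡a x≢a
    ... | no _     | there x∈as = agree x x∈as

module _ {A : Set} (xs : List A) (complete : ∀ x → x ∈ xs) where

  private
    covers : ∀ x → ∃[ y ] (y ∈ xs × x ≡ y)
    covers x = x , complete x , refl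

    ≡-resp : {P : Pred A 0ℓ} → P Respects _≡_
    ≡-resp refl = id

  ∃-dec : {P : Pred A 0ℓ} → Decidable P → Dec (∃ P)
  ∃-dec = Exhaustive.∃? sym xs covers ≡-resp

  ∀-dec : {P : Pred A 0ℓ} → Decidable P → Dec (∀ x → P x)
  ∀-dec = Exhaustive.∀? sym xs covers ≡-resp

  atMostOne⊎twoElements : DecidableEquality A → AtMostOne {A} ⊎ TwoElements A
  atMostOne⊎twoElements _≟_ with ∃-dec (λ x → ∃-dec (λ y → ¬? (x ≟ y)))
  ... | yes (x , y , x≢y) = inj₂ (x , y , x≢y)
  ... | no ∄distinct = inj₁ λ x y → decidable-stable (x ≟ y) (λ x≢y → ∄distinct (x , y , x≢y))

  module _ (_≟_ : DecidableEquality A) where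

    private
      covers-⊆ : ∀ X → ∃[ Y ] (Y ∈ subsets _≟_ xs × X ≗ₛ Y)
      covers-⊆ X = let Y , Y∈ , agree = subsets-agree _≟_ xs X in Y , Y∈ , λ x → agree x (complete x)

      ≗ₛ-sym : Symmetric (_≗ₛ_ {A})
      ≗ₛ-sym X≗Y x = sym (X≗Y x)

    ∃ₛ-dec : {P : Pred (Subset A) 0ℓ} → P Respects _≗ₛ_ → Decidable P → Dec (∃ P)
    ∃ₛ-dec = Exhaustive.∃? ≗ₛ-sym (subsets _≟_ xs) covers-⊆

    ∀ₛ-dec : {P : Pred (Subset A) 0ℓ} → P Respects _≗ₛ_ → Decidable P → Dec (∀ X → P X)
    ∀ₛ-dec = Exhaustive.∀? ≗ₛ-sym (subsets _≟_ xs) covers-⊆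

module _ (S : Subset E) where

  proj₁-injective : Injective _≡_ _≡_ (proj₁ {B = λ x → T (S x)})
  proj₁-injective {x , p} {.x , q} refl = cong (x ,_) (T-irrelevant p q)

  Sub-≟ : DecidableEquality E → DecidableEquality (Sub S)
  Sub-≟ _≟_ = ≡-dec _≟_ (λ p q → yes (T-irrelevant p q))

  subList : List E → List (Sub S)
  subList []       = []
  subList (x ∷ xs) with T? (S x)
  ... | yes p = (x , p) ∷ subList xs
  ... | no _  = subList xs

  ∈-subList : ∀ {xs} (y : Sub S) → proj₁ y ∈ xs → y ∈ subList xs
  ∈-subList {x ∷ xs} (x , p) (here refl) with T? (S x)
  ... | yes q = here (cong (x ,_) (T-irrelevant p q))
  ... | no ¬q = contradiction p ¬q
  ∈-subList {x ∷ xs} y (there y∈xs) with T? (S x)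
  ... | yes _ = there (∈-subList y y∈xs)
  ... | no _  = ∈-subList y y∈xs

  length-subList-≤ : ∀ xs → length (subList xs) ≤ length xs
  length-subList-≤ []       = z≤n
  length-subList-≤ (x ∷ xs) with T? (S x)
  ... | yes _ = s≤s (length-subList-≤ xs)
  ... | no _  = m≤n⇒m≤1+n (length-subList-≤ xs)

  length-subList-< : ∀ {x xs} → x ∈ xs → S x ≡ false → length (subList xs) < length xs
  length-subList-< {xs = y ∷ xs} (here refl) Sy≡false with T? (S y)
  ... | yes p = ⊥-elim (subst T Sy≡false p)
  ... | no _  = s≤s (length-subList-≤ xs)
  length-subList-< {xs = y ∷ xs} (there x∈xs) Sx≡false with T? (S y)
  ... | yes _ = s≤s (length-subList-< x∈xs Sx≡false)
  ... | no _  = m≤n⇒m≤1+n (length-subList-< x∈xs Sx≡false)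

IsImage : (F → E) → Subset F → Subset E → Set
IsImage ι X Y =
  (∀ e → e ∈ₛ Y → ∃[ f ] (ι f ≡ e × f ∈ₛ X)) × (∀ f → f ∈ₛ X → ι f ∈ₛ Y)

WithinRange : (F → E) → Subset E → Set
WithinRange ι Y = ∀ e → e ∈ₛ Y → ∃[ f ] (ι f ≡ e)

module _ {ι : F → E} where

  isImage-unique : ∀ {X Y Y′} → IsImage ι X Y → IsImage ι X Y′ → Y ≗ₛ Y′
  isImage-unique {Y = Y} {Y′} (Y⊆ιX , ιX⊆Y) (Y′⊆ιX , ιX⊆Y′) e = bool-ext
    (λ Ye  → let f , ιf≡e , Xf = Y⊆ιX e Ye   in subst (_∈ₛ Y′) ιf≡e (ιX⊆Y′ f Xf))
    (λ Y′e → let f , ιf≡e , Xf = Y′⊆ιX e Y′e in subst (_∈ₛ Y) ιf≡e (ιX⊆Y f Xf))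

  isImage-withinRange : ∀ {X Y} → IsImage ι X Y → WithinRange ι Y
  isImage-withinRange (Y⊆ιX , _) e Ye = let f , ιf≡e , _ = Y⊆ιX e Ye in f , ιf≡e

  isImage-resp : ∀ {X X′ Y} → X ≗ₛ X′ → IsImage ι X Y → IsImage ι X′ Y
  isImage-resp X≗X′ (Y⊆ιX , ιX⊆Y) =
    (λ e Ye → let f , ιf≡e , Xf = Y⊆ιX e Ye in f , ιf≡e , trans (sym (X≗X′ f)) Xf) ,
    (λ f X′f → ιX⊆Y f (trans (X≗X′ f) X′f))

  isImage-mono : ∀ {X X′ Y Y′} → IsImage ι X Y → IsImage ι X′ Y′ → X ⊆ X′ → Y ⊆ Y′
  isImage-mono {Y′ = Y′} (Y⊆ιX , _) (_ , ιX′⊆Y′) X⊆X′ e Ye =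
    let f , ιf≡e , Xf = Y⊆ιX e Ye in subst (_∈ₛ Y′) ιf≡e (ιX′⊆Y′ f (X⊆X′ f Xf))

  isImage-∅ : IsImage ι ∅ₛ ∅ₛ
  isImage-∅ = (λ _ ()) , (λ _ ())

  isImage-preimage : ∀ {Y} → WithinRange ι Y → IsImage ι (Y ∘ ι) Y
  isImage-preimage {Y} Y⊆range =
    (λ e Ye → let f , ιf≡e = Y⊆range e Ye in f , ιf≡e , subst (_∈ₛ Y) (sym ιf≡e) Ye) ,
    (λ _ Yιf → Yιf)

  withinRange-∘ : ∀ {G} {κ : G → F} {Y} → WithinRange (ι ∘ κ) Y → WithinRange ι Y
  withinRange-∘ {κ = κ} Y⊆range e Ye = let g , ικg≡e = Y⊆range e Ye in κ g , ικg≡e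

  isImage-∘ : ∀ {G} {κ : G → F} {X Y Z} → IsImage κ X Y → IsImage ι Y Z → IsImage (ι ∘ κ) X Z
  isImage-∘ {κ = κ} (Y⊆κX , κX⊆Y) (Z⊆ιY , ιY⊆Z) =
    (λ e Ze → let f , ιf≡e , Yf = Z⊆ιY e Ze ; g , κg≡f , Xg = Y⊆κX f Yf
              in g , trans (cong ι κg≡f) ιf≡e , Xg) ,
    (λ g Xg → ιY⊆Z (κ g) (κX⊆Y g Xg))

  isImage-liftJust : ∀ {X Y} → IsImage ι X Y → IsImage (Maybe.map ι) (liftJust X) (liftJust Y)
  isImage-liftJust (Y⊆ιX , ιX⊆Y) =
    (λ { (just e) Ye → let f , ιf≡e , Xf = Y⊆ιX e Ye in just f , cong just ιf≡e , Xf }) ,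
    (λ { (just f) Xf → ιX⊆Y f Xf })

  module _ (ι-injective : Injective _≡_ _≡_ ι) where

    isImage-pointwise : ∀ {X Y} → IsImage ι X Y → ∀ f → X f ≡ Y (ι f)
    isImage-pointwise {X} (Y⊆ιX , ιX⊆Y) f = bool-ext (ιX⊆Y f)
      (λ Yιf → let g , ιg≡ιf , Xg = Y⊆ιX (ι f) Yιf in subst (_∈ₛ X) (ι-injective ιg≡ιf) Xg)

    isImage-reflects-≗ : ∀ {X X′ Y Y′} →
      IsImage ι X Y → IsImage ι X′ Y′ → Y ≗ₛ Y′ → X ≗ₛ X′
    isImage-reflects-≗ ιX ιX′ Y≗Y′ f =
      trans (isImage-pointwise ιX f) (trans (Y≗Y′ (ι f)) (sym (isImage-pointwise ιX′ f)))

    isImage-∘⁻ : ∀ {G} {κ : G → F} {X Z} → IsImage (ι ∘ κ) X Z → IsImage κ X (Z ∘ ι)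
    isImage-∘⁻ (Z⊆ικX , ικX⊆Z) =
      (λ f Zιf → let g , ικg≡ιf , Xg = Z⊆ικX (ι f) Zιf in g , ι-injective ικg≡ιf , Xg) ,
      ικX⊆Z

-- A record rather than a Σ-type, so that with-abstraction finds λ p → X (e , p) in the goal.
private
  record TrueSomewhere (b : Bool) (g : T b → Bool) : Set where
    constructor _,_
    field
      witness : T b
      holds   : g witness ≡ true

module _ (S : Subset E) (X : Subset (Sub S)) where

  private
    liftSub-true⇒ : ∀ e → liftSub S X e ≡ true → TrueSomewhere (S e) (λ p → X (e , p))
    liftSub-true⇒ e with (λ (p : T (S e)) → X (e , p))
    ... | g with S e
    ... | true  = λ h → tt , h
    ... | false = λ ()

    liftSub-true⇐ : ∀ e → TrueSomewhere (S e) (λ p → X (e , p)) → liftSub S X e ≡ true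
    liftSub-true⇐ e with (λ (p : T (S e)) → X (e , p))
    ... | g with S e
    ... | true  = TrueSomewhere.holds
    ... | false = λ ()

  isImage-liftSub : IsImage proj₁ X (liftSub S X)
  isImage-liftSub =
    (λ e Xe → let p , Xep = liftSub-true⇒ e Xe in (e , p) , refl , Xep) ,
    (λ { (e , p) Xep → liftSub-true⇐ e (p , Xep) })

module Image {F E : Set} (enumF : List F) (completeF : ∀ f → f ∈ enumF)
             (_≟_ : DecidableEquality E) (ι : F → E) where

  image : Subset F → Subset E
  image X e = does (any? (λ f → (ι f ≟ e) ×-dec (X f ≟ᵇ true)) enumF)

  isImage-image : ∀ X → IsImage ι X (image X)
  isImage-image X =
    (λ e ιX∋e → satisfied (does≡true⇒ (any? _ enumF) ιX∋e)) ,
    (λ f Xf → dec-true (any? _ enumF) (lose (completeF f) (refl , Xf)))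

-- N is M restricted to the range of ι, with ground set renamed along ι.  Unlike IsRestriction,
-- this is closed under composition and covers the ground sets Maybe F of single-element extensions.
record Restriction {F E : Set} (ι : F → E) (N : Matroid F) (M : Matroid E) : Set where
  field
    injective     : Injective _≡_ _≡_ ι
    circuit-image : ∀ {X Y} → IsImage ι X Y → isCircuit N X ≡ isCircuit M Y

  image-circuit : ∀ {X Y} → isCircuit N X ≡ true → IsImage ι X Y → isCircuit M Y ≡ true
  image-circuit CX ιX = trans (sym (circuit-image ιX)) CX

  preimage-circuit : ∀ {Y} → isCircuit M Y ≡ true → WithinRange ι Y → isCircuit N (Y ∘ ι) ≡ true
  preimage-circuit CY Y⊆range = trans (circuit-image (isImage-preimage Y⊆range)) CY

open Restriction

IsRestriction⇒Restriction : ∀ {M : Matroid E} {S} {N : Matroid (Sub S)} →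
  IsRestriction M S N → Restriction proj₁ N M
IsRestriction⇒Restriction {M = M} {S} N-def = record
  { injective     = proj₁-injective S
  ; circuit-image = λ {X} ιX → trans (N-def X) (resp M _ _ (isImage-unique (isImage-liftSub S X) ιX))
  }

Restriction-∘ : ∀ {G} {κ : G → F} {ι : F → E} {L : Matroid G} {N : Matroid F} {M : Matroid E} →
  Restriction κ L N → Restriction ι N M → Restriction (ι ∘ κ) L M
Restriction-∘ {κ = κ} L↪N N↪M = record
  { injective     = injective L↪N ∘ injective N↪M
  ; circuit-image = λ ικX →
      trans (circuit-image L↪N (isImage-∘⁻ (injective N↪M) ικX))
            (circuit-image N↪M (isImage-preimage (withinRange-∘ {κ = κ} (isImage-withinRange ικX))))
  }

Restriction-corestrict : ∀ {M : Matroid E} {S} {M∣S : Matroid (Sub S)} {N : Matroid F} →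
  IsRestriction M S M∣S → (ι : F → Sub S) → Restriction (proj₁ ∘ ι) N M → Restriction ι N M∣S
Restriction-corestrict {S = S} M∣S-def ι N↪M = record
  { injective     = injective N↪M ∘ cong proj₁
  ; circuit-image = λ {X} {Y} ιX →
      trans (circuit-image N↪M (isImage-∘ ιX (isImage-liftSub S Y))) (sym (M∣S-def Y))
  }

module RestrictAlong (M : Matroid E) (enumF : List F) (completeF : ∀ f → f ∈ enumF)
                     (_≟F_ : DecidableEquality F) (ι : F → E) (ι-injective : Injective _≡_ _≡_ ι) where

  open Image enumF completeF (_≟_ M) ι

  private
    image-reflects-≗ : ∀ X Y → image X ≗ₛ image Y → X ≗ₛ Y
    image-reflects-≗ X Y = isImage-reflects-≗ ι-injective (isImage-image X) (isImage-image Y)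

    preimage-image : ∀ {Z} → WithinRange ι Z → image (Z ∘ ι) ≗ₛ Z
    preimage-image Z⊆range = isImage-unique (isImage-image _) (isImage-preimage Z⊆range)

    circuit-elimination : ∀ X Y e → isCircuit M (image X) ≡ true → isCircuit M (image Y) ≡ true →
      ¬ (X ≗ₛ Y) → e ∈ₛ X → e ∈ₛ Y →
      ∃[ Z ] (isCircuit M (image Z) ≡ true × (∀ x → x ∈ₛ Z → ((X x ∨ Y x) ≡ true × x ≢ e)))
    circuit-elimination X Y e CX CY X≢Y Xe Ye
      with C3 M (image X) (image Y) (ι e) CX CY (X≢Y ∘ image-reflects-≗ X Y)
              (proj₂ (isImage-image X) e Xe) (proj₂ (isImage-image Y) e Ye)
    ... | Z , CZ , Z⊆X∪Y-ιe = Z ∘ ι , trans (resp M _ _ (preimage-image Z⊆range)) CZ , Z∘ι⊆X∪Y-e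
      where
      Z⊆range : WithinRange ι Z
      Z⊆range z Zz with ∨≡true⇒ (proj₁ (Z⊆X∪Y-ιe z Zz))
      ... | inj₁ Xz = isImage-withinRange (isImage-image X) z Xz
      ... | inj₂ Yz = isImage-withinRange (isImage-image Y) z Yz
      Z∘ι⊆X∪Y-e : ∀ x → Z (ι x) ≡ true → (X x ∨ Y x) ≡ true × x ≢ e
      Z∘ι⊆X∪Y-e x Zιx = let X∪Yιx , ιx≢ιe = Z⊆X∪Y-ιe (ι x) Zιx in
        trans (cong₂ _∨_ (isImage-pointwise ι-injective (isImage-image X) x)
                         (isImage-pointwise ι-injective (isImage-image Y) x)) X∪Yιx ,
        ιx≢ιe ∘ cong ι

  restrictAlong : Matroid F
  restrictAlong = record
    { enum      = enumF
    ; complete  = completeF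
    ; _≟_       = _≟F_
    ; isCircuit = λ X → isCircuit M (image X)
    ; resp      = λ X Y X≗Y → resp M _ _
                    (isImage-unique (isImage-image X) (isImage-resp (λ f → sym (X≗Y f)) (isImage-image Y)))
    ; C1        = trans (resp M _ _ (isImage-unique (isImage-image ∅ₛ) isImage-∅)) (C1 M)
    ; C2        = λ X Y CX CY X⊆Y → image-reflects-≗ X Y
                    (C2 M (image X) (image Y) CX CY (isImage-mono (isImage-image X) (isImage-image Y) X⊆Y))
    ; C3        = circuit-elimination
    }

  restrictAlong-restriction : Restriction ι restrictAlong M
  restrictAlong-restriction = record
    { injective     = ι-injective
    ; circuit-image = λ {X} ιX → resp M _ _ (isImage-unique (isImage-image X) ιX)
    }

module _ (M : Matroid E) (S : Subset E) where

  private
    subList-complete : ∀ y → y ∈ subList S (enum M)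
    subList-complete y = ∈-subList S y (complete M (proj₁ y))

    module Along =
      RestrictAlong M (subList S (enum M)) subList-complete (Sub-≟ S (_≟_ M)) proj₁ (proj₁-injective S)

  restrictTo : Matroid (Sub S)
  restrictTo = Along.restrictAlong

  restrictTo-isRestriction : IsRestriction M S restrictTo
  restrictTo-isRestriction X = circuit-image Along.restrictAlong-restriction (isImage-liftSub S X)

countOutside : Subset E → List E → ℕ
countOutside Y []       = 0
countOutside Y (x ∷ xs) = if Y x then countOutside Y xs else suc (countOutside Y xs)

module _ {Y Z : Subset E} (Y⊆Z : Y ⊆ Z) where

  countOutside-anti : ∀ xs → countOutside Z xs ≤ countOutside Y xs
  countOutside-anti []       = z≤n
  countOutside-anti (x ∷ xs) with Y x in Yx | Z x in Zx
  ... | true  | true  = countOutside-anti xs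
  ... | true  | false = contradiction (trans (sym (Y⊆Z x Yx)) Zx) λ ()
  ... | false | true  = m≤n⇒m≤1+n (countOutside-anti xs)
  ... | false | false = s≤s (countOutside-anti xs)

  countOutside-strict : ∀ {x xs} → x ∈ xs → Z x ≡ true → Y x ≡ false →
    countOutside Z xs < countOutside Y xs
  countOutside-strict {xs = y ∷ xs} (here refl) Zy Yy with Y y | Z y
  countOutside-strict {xs = y ∷ xs} (here refl) refl refl | false | true = s≤s (countOutside-anti xs)
  countOutside-strict {xs = y ∷ xs} (there x∈xs) Zx Yx with Y y in Yy | Z y in Zy
  ... | true  | true  = countOutside-strict x∈xs Zx Yx
  ... | true  | false = contradiction (trans (sym (Y⊆Z y Yy)) Zy) λ ()
  ... | false | true  = m≤n⇒m≤1+n (countOutside-strict x∈xs Zx Yx)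
  ... | false | false = s≤s (countOutside-strict x∈xs Zx Yx)

full : Subset E
full _ = true

module Components (M : Matroid E) where

  private
    ∃ₛ? : {P : Pred (Subset E) 0ℓ} → P Respects _≗ₛ_ → Decidable P → Dec (∃ P)
    ∃ₛ? = ∃ₛ-dec (enum M) (complete M) (_≟_ M)

    ∃? : {P : Pred E 0ℓ} → Decidable P → Dec (∃ P)
    ∃? = ∃-dec (enum M) (complete M)

    ∀? : {P : Pred E 0ℓ} → Decidable P → Dec (∀ x → P x)
    ∀? = ∀-dec (enum M) (complete M)

  SharedCircuit : E → E → Subset E → Set
  SharedCircuit x y C = isCircuit M C ≡ true × x ∈ₛ C × y ∈ₛ C

  sharedCircuit? : ∀ x y → Dec (∃ (SharedCircuit x y))
  sharedCircuit? x y =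
    ∃ₛ? resp-shared (λ C → (isCircuit M C ≟ᵇ true) ×-dec (C x ≟ᵇ true) ×-dec (C y ≟ᵇ true))
    where
    resp-shared : SharedCircuit x y Respects _≗ₛ_
    resp-shared {C} {C′} C≗C′ (CC , Cx , Cy) =
      trans (sym (resp M C C′ C≗C′)) CC , trans (sym (C≗C′ x)) Cx , trans (sym (C≗C′ y)) Cy

  commonCircuitSet? : ∀ X → Dec (CommonCircuitSet M X)
  commonCircuitSet? X = ∀? λ x → ∀? λ y →
    (X x ≟ᵇ true) →-dec (X y ≟ᵇ true) →-dec ¬? (_≟_ M x y) →-dec sharedCircuit? x y

  commonCircuitSet-resp : CommonCircuitSet M Respects _≗ₛ_
  commonCircuitSet-resp X≗X′ ccsX x y X′x X′y =
    ccsX x y (trans (X≗X′ x) X′x) (trans (X≗X′ y) X′y)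

  ⊆? : ∀ X Y → Dec (X ⊆ Y)
  ⊆? X Y = ∀? λ x → (X x ≟ᵇ true) →-dec (Y x ≟ᵇ true)

  ProperCommonCircuitSuperset : Subset E → Subset E → Set
  ProperCommonCircuitSuperset Y Z = CommonCircuitSet M Z × Y ⊆ Z × ∃[ x ] (Z x ≡ true × Y x ≡ false)

  properCommonCircuitSuperset-resp : ∀ Y → ProperCommonCircuitSuperset Y Respects _≗ₛ_
  properCommonCircuitSuperset-resp Y Z≗Z′ (ccsZ , Y⊆Z , x , Zx , Yx) =
    commonCircuitSet-resp Z≗Z′ ccsZ , (λ y Yy → trans (sym (Z≗Z′ y)) (Y⊆Z y Yy)) ,
    x , trans (sym (Z≗Z′ x)) Zx , Yx

  properCommonCircuitSuperset? : ∀ Y → Decidable (ProperCommonCircuitSuperset Y)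
  properCommonCircuitSuperset? Y Z =
    commonCircuitSet? Z ×-dec ⊆? Y Z ×-dec ∃? (λ x → (Z x ≟ᵇ true) ×-dec (Y x ≟ᵇ false))

  extendToComponent : ∀ {X} → CommonCircuitSet M X → ∃[ C ] (Component M C × X ⊆ C)
  extendToComponent {X} ccsX = grow X ccsX (λ _ → id) (<-wellFounded (countOutside X (enum M)))
    where
    grow : ∀ Y → CommonCircuitSet M Y → X ⊆ Y → Acc _<_ (countOutside Y (enum M)) →
           ∃[ C ] (Component M C × X ⊆ C)
    grow Y ccsY X⊆Y (acc smaller)
      with ∃ₛ? (properCommonCircuitSuperset-resp Y) (properCommonCircuitSuperset? Y)
    ... | yes (Z , ccsZ , Y⊆Z , x , Zx , Yx) =
      grow Z ccsZ (λ y Xy → Y⊆Z y (X⊆Y y Xy)) (smaller (countOutside-strict Y⊆Z (complete M x) Zx Yx))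
    ... | no maximal = Y , (ccsY , Y-maximal) , X⊆Y
      where
      Y-maximal : ∀ Z → Y ⊆ Z → CommonCircuitSet M Z → Z ⊆ Y
      Y-maximal Z Y⊆Z ccsZ z Zz with Y z in Yz
      ... | true  = refl
      ... | false = ⊥-elim (maximal (Z , ccsZ , Y⊆Z , z , Zz , Yz))

  private
    singleton : E → Subset E
    singleton a x = does (_≟_ M x a)

    singleton-commonCircuitSet : ∀ a → CommonCircuitSet M (singleton a)
    singleton-commonCircuitSet a x y x≡a y≡a x≢y =
      contradiction (trans (does≡true⇒ (_≟_ M x a) x≡a) (sym (does≡true⇒ (_≟_ M y a) y≡a))) x≢y

  connected⇒commonCircuitSet : Connected M → CommonCircuitSet M full
  connected⇒commonCircuitSet (X , (ccsX , _) , unique) a b _ _ = ccsX a b (∈X a) (∈X b)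
    where
    ∈X : ∀ a → a ∈ₛ X
    ∈X a = let C , compC , a∈C = extendToComponent (singleton-commonCircuitSet a) in
           trans (sym (unique C compC a)) (a∈C a (dec-true (_≟_ M a a) refl))

  commonCircuitSet⇒connected : CommonCircuitSet M full → Connected M
  commonCircuitSet⇒connected ccsE = full , (ccsE , λ _ _ _ _ _ → refl) , unique
    where
    unique : ∀ Y → Component M Y → Y ≗ₛ full
    unique Y (_ , Y-maximal) x = Y-maximal full (λ _ _ → refl) ccsE x refl

  connected? : Dec (Connected M)
  connected? = map′ commonCircuitSet⇒connected connected⇒commonCircuitSet (commonCircuitSet? full)

  component-proper : ¬ Connected M → ∀ {C} → Component M C → ∃[ x ] (C x ≡ false)
  component-proper ¬connected {C} (ccsC , _) with ∃? (λ x → C x ≟ᵇ false)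
  ... | yes x∉C = x∉C
  ... | no  ∄x∉C =
    contradiction (commonCircuitSet⇒connected (commonCircuitSet-resp C≗full ccsC)) ¬connected
    where
    C≗full : C ≗ₛ full
    C≗full x = ¬-not (λ Cx≡false → ∄x∉C (x , Cx≡false))

connectedRestriction⊆component : ∀ {ι : F → E} {N : Matroid F} {M : Matroid E} →
  Restriction ι N M → Connected N → ∃[ C ] (Component M C × ∀ f → ι f ∈ₛ C)
connectedRestriction⊆component {ι = ι} {N} {M} N↪M connN =
  let C , compC , ιF⊆C = Components.extendToComponent M ccs-ιF
  in C , compC , λ f → ιF⊆C (ι f) (proj₂ (isImage-image full) f refl)
  where
  open Image (enum N) (complete N) (_≟_ M) ι

  ccs-ιF : CommonCircuitSet M (image full)
  ccs-ιF x y ιF∋x ιF∋y x≢y =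
    let a , ιa≡x , _ = proj₁ (isImage-image full) x ιF∋x
        b , ιb≡y , _ = proj₁ (isImage-image full) y ιF∋y
        a≢b = λ a≡b → x≢y (trans (sym ιa≡x) (trans (cong ι a≡b) ιb≡y))
        Z , CZ , Za , Zb = Components.connected⇒commonCircuitSet N connN a b refl refl a≢b
    in image Z , image-circuit N↪M CZ (isImage-image Z) ,
       subst (_∈ₛ image Z) ιa≡x (proj₂ (isImage-image Z) a Za) ,
       subst (_∈ₛ image Z) ιb≡y (proj₂ (isImage-image Z) b Zb)

Depth≤-suc : ∀ {k} {M : Matroid E} → Depth≤ k M → Depth≤ (suc k) M
Depth≤-suc (small _ atMostOne)                = small (s≤s z≤n) atMostOne
Depth≤-suc (disconnected two ¬conn depths)     =
  disconnected two ¬conn λ C compC MC MC-def → Depth≤-suc (depths C compC MC MC-def)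
Depth≤-suc (deletion two conn e M∖e M∖e-def d) = deletion two conn e M∖e M∖e-def (Depth≤-suc d)
Depth≤-suc (cstar two conn M′ M′≠M M⇝M′ d)     = cstar two conn M′ M′≠M M⇝M′ (Depth≤-suc d)

Depth≤⇒1≤ : ∀ {k} {M : Matroid E} → Depth≤ k M → 1 ≤ k
Depth≤⇒1≤ (small 1≤k _)                      = 1≤k
Depth≤⇒1≤ {M = M} (disconnected _ _ depths) =
  let C , compC , _ = Components.extendToComponent M {∅ₛ} (λ _ _ ())
  in Depth≤⇒1≤ (depths C compC (restrictTo M C) (restrictTo-isRestriction M C))
Depth≤⇒1≤ (deletion _ _ _ _ _ _)             = s≤s z≤n
Depth≤⇒1≤ (cstar _ _ _ _ _ _)                = s≤s z≤n

MinimalTrace : Matroid (Maybe E) → Subset E → Set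
MinimalTrace M⁺ X = TraceOfCircuit M⁺ X × (∀ Y → TraceOfCircuit M⁺ Y → Y ⊆ X → X ⊆ Y)

isImage-unjust : ∀ {ι : F → E} {X Y} → IsImage (Maybe.map ι) X Y → IsImage ι (X ∘ just) (Y ∘ just)
isImage-unjust (Y⊆ιX , ιX⊆Y) =
  (λ e Yje → unjust (Y⊆ιX (just e) Yje)) , (λ f Xjf → ιX⊆Y (just f) Xjf)
  where
  unjust : ∀ {ι : F → E} {X e} →
    ∃[ c ] (Maybe.map ι c ≡ just e × c ∈ₛ X) → ∃[ f ] (ι f ≡ e × just f ∈ₛ X)
  unjust (just f , ιf≡e , Xjf) = f , just-injective ιf≡e , Xjf

module _ {ι : F → E} {N⁺ : Matroid (Maybe F)} {M⁺ : Matroid (Maybe E)}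
         (N⁺↪M⁺ : Restriction (Maybe.map ι) N⁺ M⁺) where

  open Image (enum N⁺) (complete N⁺) (_≟_ M⁺) (Maybe.map ι)

  private
    ι-injective : Injective _≡_ _≡_ ι
    ι-injective ιf≡ιg = just-injective (injective N⁺↪M⁺ (cong just ιf≡ιg))

    image-fromJust : Subset F → Subset E
    image-fromJust Z = image (liftJust Z) ∘ just

    isImage-fromJust : ∀ Z → IsImage ι Z (image-fromJust Z)
    isImage-fromJust Z = isImage-unjust (isImage-image (liftJust Z))

  trace-image : ∀ {X Y} → IsImage ι X Y → TraceOfCircuit N⁺ X → TraceOfCircuit M⁺ Y
  trace-image ιX ((f , Xf) , C , CC , C∘just≗X) =
    (ι f , proj₂ ιX f Xf) , image C , image-circuit N⁺↪M⁺ CC (isImage-image C) ,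
    isImage-unique (isImage-resp C∘just≗X (isImage-unjust (isImage-image C))) ιX

  trace-preimage : ∀ {X Y} → IsImage ι X Y → TraceOfCircuit M⁺ Y → TraceOfCircuit N⁺ X
  trace-preimage {X} {Y} ιX ((e , Ye) , D , CD , D∘just≗Y) =
    (let f , _ , Xf = proj₁ ιX e Ye in f , Xf) ,
    D ∘ Maybe.map ι , preimage-circuit N⁺↪M⁺ CD D⊆range ,
    λ x → trans (D∘just≗Y (ι x)) (sym (isImage-pointwise ι-injective ιX x))
    where
    D⊆range : WithinRange (Maybe.map ι) D
    D⊆range nothing  _   = nothing , refl
    D⊆range (just e) Dje =
      let f , ιf≡e , _ = proj₁ ιX e (trans (sym (D∘just≗Y e)) Dje) in just f , cong just ιf≡e

  minimalTrace-image : ∀ {X Y} → IsImage ι X Y → MinimalTrace N⁺ X → MinimalTrace M⁺ Y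
  minimalTrace-image {X} {Y} ιX (traceX , minX) = trace-image ιX traceX , minY
    where
    minY : ∀ W → TraceOfCircuit M⁺ W → W ⊆ Y → Y ⊆ W
    minY W traceW W⊆Y =
      let ι⁻¹W = isImage-preimage (λ e We → isImage-withinRange ιX e (W⊆Y e We))
          ι⁻¹W⊆X = λ f Wιf → trans (isImage-pointwise ι-injective ιX f) (W⊆Y (ι f) Wιf)
      in isImage-mono ιX ι⁻¹W (minX (W ∘ ι) (trace-preimage ι⁻¹W traceW) ι⁻¹W⊆X)

  minimalTrace-preimage : ∀ {X Y} → IsImage ι X Y → MinimalTrace M⁺ Y → MinimalTrace N⁺ X
  minimalTrace-preimage {X} {Y} ιX (traceY , minY) = trace-preimage ιX traceY , minX
    where
    minX : ∀ Z → TraceOfCircuit N⁺ Z → Z ⊆ X → X ⊆ Z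
    minX Z traceZ Z⊆X x Xx =
      let ιZ = isImage-fromJust Z
          Y⊆ιZ = minY (image-fromJust Z) (trace-image ιZ traceZ) (isImage-mono ιZ ιX Z⊆X)
      in trans (isImage-pointwise ι-injective ιZ x) (Y⊆ιZ (ι x) (proj₂ ιX x Xx))

-- N⁺ is M⁺ restricted to the range of Maybe.map ι, and N′ is M′ restricted to the range of ι.
cstar-restriction : {F E : Set} {ι : F → E} {N : Matroid F} {M M′ : Matroid E} →
  Restriction ι N M → CStarTransformation M M′ →
  ∃[ N′ ] (CStarTransformation N N′ × Restriction ι N′ M′)
cstar-restriction {F} {ι = ι} {N} {M} {M′} N↪M (M⁺ , M=M⁺\f , M′=M⁺/f) =
  Along′.restrictAlong , (Along⁺.restrictAlong , N=N⁺\f , N′=N⁺/f) , Along′.restrictAlong-restriction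
  where
  enum⁺ : List (Maybe F)
  enum⁺ = nothing ∷ List.map just (enum N)

  complete⁺ : ∀ c → c ∈ enum⁺
  complete⁺ nothing  = here refl
  complete⁺ (just f) = there (∈-map⁺ just (complete N f))

  module Along⁺ =
    RestrictAlong M⁺ enum⁺ complete⁺ (Maybe-≡-dec (_≟_ N)) (Maybe.map ι) (map-injective (injective N↪M))
  module Along′ = RestrictAlong M′ (enum N) (complete N) (_≟_ N) ι (injective N↪M)
  open Image (enum N) (complete N) (_≟_ M) ι

  N=N⁺\f : IsDeletionOfNew Along⁺.restrictAlong N
  N=N⁺\f X = begin
    isCircuit N X                               ≡⟨ circuit-image N↪M (isImage-image X) ⟩
    isCircuit M (image X)                       ≡⟨ M=M⁺\f (image X) ⟩
    isCircuit M⁺ (liftJust (image X))           ≡⟨ circuit-image Along⁺.restrictAlong-restriction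
                                                                  (isImage-liftJust (isImage-image X)) ⟨
    isCircuit Along⁺.restrictAlong (liftJust X) ∎

  N′=N⁺/f : IsContractionOfNew Along⁺.restrictAlong Along′.restrictAlong
  N′=N⁺/f X =
    (λ CX → minimalTrace-preimage N⁺↪M⁺ ιX
              (proj₁ (M′=M⁺/f (image X)) (trans (sym (circuit-image N′↪M′ ιX)) CX))) ,
    (λ minX → trans (circuit-image N′↪M′ ιX)
                (proj₂ (M′=M⁺/f (image X)) (minimalTrace-image N⁺↪M⁺ ιX minX)))
    where
    ιX : IsImage ι X (image X)
    ιX = isImage-image X
    N⁺↪M⁺ : Restriction (Maybe.map ι) Along⁺.restrictAlong M⁺
    N⁺↪M⁺ = Along⁺.restrictAlong-restriction
    N′↪M′ : Restriction ι Along′.restrictAlong M′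
    N′↪M′ = Along′.restrictAlong-restriction

sameMatroid? : (M M′ : Matroid E) → Dec (SameMatroid M M′)
sameMatroid? M M′ =
  ∀ₛ-dec (enum M) (complete M) (_≟_ M) resp-same (λ X → isCircuit M X ≟ᵇ isCircuit M′ X)
  where
  resp-same : (λ X → isCircuit M X ≡ isCircuit M′ X) Respects _≗ₛ_
  resp-same {X} {Y} X≗Y MX≡M′X = trans (sym (resp M X Y X≗Y)) (trans MX≡M′X (resp M′ X Y X≗Y))

Restriction-sameMatroid : ∀ {ι : F → E} {N N′ : Matroid F} {M : Matroid E} →
  SameMatroid N N′ → Restriction ι N M → Restriction ι N′ M
Restriction-sameMatroid N≗N′ N↪M = record
  { injective     = injective N↪M
  ; circuit-image = λ {X} ιX → trans (sym (N≗N′ X)) (circuit-image N↪M ιX)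
  }

RestrictionsDepth≤ : ℕ → Matroid E → Set₁
RestrictionsDepth≤ {E} k M = ∀ {F} {N : Matroid F} {ι : F → E} → Restriction ι N M → Depth≤ k N

ConnectedRestrictionsDepth≤ : ℕ → Matroid E → Set₁
ConnectedRestrictionsDepth≤ {E} k M =
  ∀ {F} {N : Matroid F} {ι : F → E} → Restriction ι N M → TwoElements F → Connected N → Depth≤ k N

restrictionsDepth≤-fromConnected : ∀ {k} {M : Matroid E} →
  1 ≤ k → ConnectedRestrictionsDepth≤ k M → RestrictionsDepth≤ k M
restrictionsDepth≤-fromConnected {k = k} {M} 1≤k connected-case {N = N} N↪M =
  go N↪M (enum N) (complete N) (<-wellFounded _)
  where
  go : ∀ {G} {L : Matroid G} {κ} → Restriction κ L M →
       (xs : List G) → (∀ g → g ∈ xs) → Acc _<_ (length xs) → Depth≤ k L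
  go {L = L} L↪M xs complete-xs (acc smaller) with atMostOne⊎twoElements xs complete-xs (_≟_ L)
  ... | inj₁ atMostOne = small 1≤k atMostOne
  ... | inj₂ two with Components.connected? L
  ...   | yes conn = connected-case L↪M two conn
  ...   | no ¬conn = disconnected two ¬conn λ C compC LC LC-def →
    let x , Cx≡false = Components.component-proper L ¬conn compC
    in go (Restriction-∘ (IsRestriction⇒Restriction LC-def) L↪M)
          (subList C xs) (λ y → ∈-subList C y (complete-xs (proj₁ y)))
          (smaller (length-subList-< C (complete-xs x) Cx≡false))

component-case : ∀ {k} {M : Matroid E} →
  (∀ C → Component M C → (MC : Matroid (Sub C)) → IsRestriction M C MC → RestrictionsDepth≤ k MC) →
  ConnectedRestrictionsDepth≤ k M
component-case {M = M} depths {ι = ι} N↪M _ conn =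
  let C , compC , ιF⊆C = connectedRestriction⊆component N↪M conn
      M∣C-def = restrictTo-isRestriction M C
  in depths C compC (restrictTo M C) M∣C-def
       (Restriction-corestrict M∣C-def (λ f → ι f , Equivalence.from T-≡ (ιF⊆C f)) N↪M)

deletion-case : ∀ {k} {M : Matroid E} {e} {M∖e : Matroid (Sub (allBut M e))} →
  IsRestriction M (allBut M e) M∖e → RestrictionsDepth≤ k M∖e →
  ConnectedRestrictionsDepth≤ (suc k) M
deletion-case {M = M} {e} M∖e-def depth∖e {F} {N} {ι} N↪M two conn
  with ∃-dec (enum N) (complete N) (λ f → _≟_ M (ι f) e)
... | yes (f , ιf≡e) =
  deletion two conn f (restrictTo N (allBut N f)) N∖f-def
    (depth∖e (Restriction-corestrict M∖e-def ι∖f (Restriction-∘ (IsRestriction⇒Restriction N∖f-def) N↪M)))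
  where
  N∖f-def : IsRestriction N (allBut N f) (restrictTo N (allBut N f))
  N∖f-def = restrictTo-isRestriction N (allBut N f)
  ι∖f : Sub (allBut N f) → Sub (allBut M e)
  ι∖f (x , x≢f) =
    ι x , fromWitnessFalse (λ ιx≡e → toWitnessFalse x≢f (injective N↪M (trans ιx≡e (sym ιf≡e))))
... | no e∉ιF = Depth≤-suc (depth∖e (Restriction-corestrict M∖e-def ι∖e N↪M))
  where
  ι∖e : F → Sub (allBut M e)
  ι∖e f = ι f , fromWitnessFalse (λ ιf≡e → e∉ιF (f , ιf≡e))

-- The constructor cstar demands N′ ≠ N; when the transformation fixes N, N is a restriction of M′.
cstar-case : ∀ {k} {M M′ : Matroid E} → CStarTransformation M M′ → RestrictionsDepth≤ k M′ →
  ConnectedRestrictionsDepth≤ (suc k) M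
cstar-case M⇝M′ depth′ {N = N} N↪M two conn with cstar-restriction N↪M M⇝M′
... | N′ , N⇝N′ , N′↪M′ with sameMatroid? N′ N
...   | yes N′≗N = Depth≤-suc (depth′ (Restriction-sameMatroid N′≗N N′↪M′))
...   | no  N′≠N = cstar two conn N′ N′≠N N⇝N′ (depth′ N′↪M′)

mutual
  restrictionsDepth≤ : ∀ {k} {M : Matroid E} → Depth≤ k M → RestrictionsDepth≤ k M
  restrictionsDepth≤ d = restrictionsDepth≤-fromConnected (Depth≤⇒1≤ d) (connectedRestrictionsDepth≤ d)

  connectedRestrictionsDepth≤ : ∀ {k} {M : Matroid E} → Depth≤ k M → ConnectedRestrictionsDepth≤ k M
  connectedRestrictionsDepth≤ (small 1≤k atMostOne) N↪M _ _ =
    small 1≤k (λ x y → injective N↪M (atMostOne _ _))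
  connectedRestrictionsDepth≤ (disconnected _ _ depths) =
    component-case (λ C compC MC MC-def → restrictionsDepth≤ (depths C compC MC MC-def))
  connectedRestrictionsDepth≤ (deletion _ _ _ _ M∖e-def d) = deletion-case M∖e-def (restrictionsDepth≤ d)
  connectedRestrictionsDepth≤ (cstar _ _ _ _ M⇝M′ d)       = cstar-case M⇝M′ (restrictionsDepth≤ d)

mainTheorem8 : {E : Set} (M : Matroid E) (D : Subset E)
    (N : Matroid (Sub (λ x → not (D x)))) → IsRestriction M (λ x → not (D x)) N →
    (dM dN : ℕ) → IsCdDepth M dM → IsCdDepth N dN → dN ≤ dM
mainTheorem8 M D N N-def dM dN (depthM , _) (_ , leastN) =
  leastN dM (restrictionsDepth≤ depthM (IsRestriction⇒Restriction N-def))
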